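{- Let $\Sigma^*$ be the structure of all nonempty finite strings over $\{a,b\}$ with $*$ concatenation, and let $\mathcal{AE}(x)$ hold iff $\alpha(x)=\beta(x)+1$ and $\alpha(u)\le\beta(u)$ for every proper initial segment $u$ of $x$, where $\alpha(x),\beta(x)$ count the occurrences of $a$, resp. $b$, in $x$. If $\mathcal{AE}(x)$, $\mathcal{AE}(y)$, $\mathcal{AE}(z)$ and $x\subseteq_p b*y*z$, then $x=b*y*z$ or $x\subseteq_p y$ or $x\subseteq_p z$.
   Context: $xBy$ means $\exists w\,(x*w=y)$; $xEy$ means $\exists w\,(w*x=y)$; $x\subseteq_p y$ means $x=y\vee xBy\vee xEy\vee\exists y_1\exists y_2\,(y=y_1*(x*y_2))$ ($x$ is a substring of $y$). A proper initial segment of $x$ is a $u$ with $uBx$. -}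

module Defs where

open import Data.Nat using (ℕ; zero; suc; _+_; _≤_)
open import Data.List using (List; []; _∷_)
open import Data.List.NonEmpty using (List⁺; _∷_; [_]; _⁺++⁺_; toList)
open import Data.Product using (∃; _×_)
open import Data.Sum using (_⊎_)
open import Relation.Binary.PropositionalEquality using (_≡_)

data Sym : Set where
  a b : Sym

Str : Set
Str = List⁺ Sym

infixr 5 _*_
_*_ : Str → Str → Str
x * y = x ⁺++⁺ y

𝕒 𝕓 : Str
𝕒 = [ a ]
𝕓 = [ b ]

countA countB : List Sym → ℕ
countA [] = 0
countA (a ∷ s) = suc (countA s)
countA (b ∷ s) = countA s
countB [] = 0
countB (a ∷ s) = countB s
countB (b ∷ s) = suc (countB s)

α β : Str → ℕ
α x = countA (toList x)
β x = countB (toList x)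

_B_ : Str → Str → Set
x B y = ∃ λ w → x * w ≡ y

_E_ : Str → Str → Set
x E y = ∃ λ w → w * x ≡ y

_⊆p_ : Str → Str → Set
x ⊆p y = x ≡ y ⊎ x B y ⊎ x E y ⊎ ∃ λ y₁ → ∃ λ y₂ → y ≡ y₁ * (x * y₂)

AE : Str → Set
AE x = (α x ≡ suc (β x)) × (∀ u → u B x → α u ≤ β u)

-- Read a as +1 and b as −1. An AE word has weight 1 while its proper prefixes have
-- weight ≤ 0, so every nonempty suffix has positive weight; hence no nonempty proper
-- prefix of an AE word is a suffix of another AE word, and an occurrence of x in
-- b y z can neither straddle the border between y and z nor be a proper prefix of
-- b y z: in the latter case x = b x' with x' a proper prefix of y z, and such
-- prefixes have weight ≤ 1, leaving x with weight ≤ 0.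
module Submission where

open import Defs
open import Data.Nat using (suc; _+_; _≤_; _<_; z≤n)
open import Data.Nat.Properties using
  (≤-refl; m≤n⇒m≤1+n; +-mono-≤; +-cancelˡ-≤; +-suc; <⇒≱; n≮n; module ≤-Reasoning)
open import Data.List using (List; []; _∷_; _++_)
open import Data.List.Properties using (∷-injective; ∷-injectiveʳ; ++-identityʳ)
open import Data.List.NonEmpty using (_∷_; toList)
open import Data.Product using (∃; ∃₂; _×_; _,_)
open import Data.Sum as Sum using (_⊎_; inj₁; inj₂)
open import Data.Empty using (⊥-elim)
open import Relation.Nullary using (¬_)
open import Relation.Binary.PropositionalEquality using (_≡_; refl; sym; trans; cong; subst)

++-equidivisible : ∀ {A : Set} (p q r s : List A) → p ++ q ≡ r ++ s →
  (∃ λ m → p ≡ r ++ m × s ≡ m ++ q) ⊎ (∃ λ m → r ≡ p ++ m × q ≡ m ++ s)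
++-equidivisible []      q r       s eq = inj₂ (r , refl , eq)
++-equidivisible (x ∷ p) q []      s eq = inj₁ (x ∷ p , refl , sym eq)
++-equidivisible (x ∷ p) q (y ∷ r) s eq with ∷-injective eq
... | refl , eq′ with ++-equidivisible p q r s eq′
...   | inj₁ (m , p≡r++m , s≡m++q) = inj₁ (m , cong (x ∷_) p≡r++m , s≡m++q)
...   | inj₂ (m , r≡p++m , q≡m++s) = inj₂ (m , cong (x ∷_) r≡p++m , q≡m++s)

countA-++ : ∀ u v → countA (u ++ v) ≡ countA u + countA v
countA-++ []      v = refl
countA-++ (a ∷ u) v = cong suc (countA-++ u v)
countA-++ (b ∷ u) v = countA-++ u v

countB-++ : ∀ u v → countB (u ++ v) ≡ countB u + countB v
countB-++ []      v = refl
countB-++ (a ∷ u) v = countB-++ u v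
countB-++ (b ∷ u) v = cong suc (countB-++ u v)

IsAE : List Sym → Set
IsAE s = countA s ≡ suc (countB s) × (∀ u w ws → u ++ w ∷ ws ≡ s → countA u ≤ countB u)

Infix : List Sym → List Sym → Set
Infix s t = ∃₂ λ p q → p ++ s ++ q ≡ t

prefix-excess≤1 : ∀ {s} u v → IsAE s → u ++ v ≡ s → countA u ≤ suc (countB u)
prefix-excess≤1 u []       (total , _)            refl
  rewrite ++-identityʳ u = subst (_≤ suc (countB u)) (sym total) ≤-refl
prefix-excess≤1 u (w ∷ ws) (_ , properPrefix) eq = m≤n⇒m≤1+n (properPrefix u w ws eq)

nonemptySuffix-excess>0 : ∀ {s} u w ws → IsAE s → u ++ w ∷ ws ≡ s →
  countB (w ∷ ws) < countA (w ∷ ws)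
nonemptySuffix-excess>0 u w ws (total , properPrefix) refl =
  +-cancelˡ-≤ (countB u) _ _ (begin
    countB u + suc (countB v)   ≡⟨ +-suc (countB u) (countB v) ⟩
    suc (countB u + countB v)   ≡⟨ cong suc (sym (countB-++ u v)) ⟩
    suc (countB (u ++ v))       ≡⟨ sym total ⟩
    countA (u ++ v)             ≡⟨ countA-++ u v ⟩
    countA u + countA v         ≤⟨ +-mono-≤ (properPrefix u w ws refl) ≤-refl ⟩
    countB u + countA v         ∎)
  where
  v = w ∷ ws
  open ≤-Reasoning

toList-injective : {u v : Str} → toList u ≡ toList v → u ≡ v
toList-injective {_ ∷ _} {_ ∷ _} refl = refl

AE⇒IsAE : ∀ {x} → AE x → IsAE (toList x)
AE⇒IsAE (total , properPrefix) = total , λ where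
  []      _ _  _  → z≤n
  (c ∷ u) w ws eq → properPrefix (c ∷ u) (w ∷ ws , toList-injective eq)

⊆p⇒Infix : ∀ {x y} → x ⊆p y → Infix (toList x) (toList y)
⊆p⇒Infix {x} (inj₁ refl)                           = [] , [] , ++-identityʳ (toList x)
⊆p⇒Infix     (inj₂ (inj₁ (w , refl)))              = [] , toList w , refl
⊆p⇒Infix {x} (inj₂ (inj₂ (inj₁ (w , refl))))       =
  toList w , [] , cong (toList w ++_) (++-identityʳ (toList x))
⊆p⇒Infix     (inj₂ (inj₂ (inj₂ (y₁ , y₂ , refl)))) = toList y₁ , toList y₂ , refl

Infix⇒⊆p : ∀ {x y} → Infix (toList x) (toList y) → x ⊆p y
Infix⇒⊆p {x} ([]     , []     , eq) =
  inj₁ (toList-injective (trans (sym (++-identityʳ (toList x))) eq))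
Infix⇒⊆p     ([]     , w ∷ ws , eq) = inj₂ (inj₁ (w ∷ ws , toList-injective eq))
Infix⇒⊆p {x} (v ∷ vs , []     , eq) = inj₂ (inj₂ (inj₁ (v ∷ vs ,
  toList-injective (trans (cong ((v ∷ vs) ++_) (sym (++-identityʳ (toList x)))) eq))))
Infix⇒⊆p     (v ∷ vs , w ∷ ws , eq) =
  inj₂ (inj₂ (inj₂ (v ∷ vs , w ∷ ws , sym (toList-injective eq))))

AE-overlap-trivial : ∀ {x y} p m n → IsAE x → IsAE y → p ++ m ≡ y → m ++ n ≡ x →
  m ≡ [] ⊎ n ≡ []
AE-overlap-trivial p []       _        _                  _   _      _      = inj₁ refl
AE-overlap-trivial p (_ ∷ _)  []       _                  _   _      _      = inj₂ refl
AE-overlap-trivial p (v ∷ vs) (w ∷ ws) (_ , properPrefix) aeY suffix prefix =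
  ⊥-elim (<⇒≱ (nonemptySuffix-excess>0 p v vs aeY suffix) (properPrefix (v ∷ vs) w ws prefix))

properPrefix-++-excess≤1 : ∀ {y z} u w ws → IsAE y → IsAE z → u ++ w ∷ ws ≡ y ++ z →
  countA u ≤ suc (countB u)
properPrefix-++-excess≤1 {y} {z} u w ws aeY (_ , properPrefixZ) eq
  with ++-equidivisible u (w ∷ ws) y z eq
... | inj₂ (m , y≡u++m , _) = prefix-excess≤1 u m aeY (sym y≡u++m)
... | inj₁ (m , refl , z≡m++v) = begin
  countA (y ++ m)             ≡⟨ countA-++ y m ⟩
  countA y + countA m         ≤⟨ +-mono-≤ (prefix-excess≤1 y [] aeY (++-identityʳ y))
                                          (properPrefixZ m w ws (sym z≡m++v)) ⟩
  suc (countB y) + countB m   ≡⟨ cong suc (sym (countB-++ y m)) ⟩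
  suc (countB (y ++ m))       ∎
  where open ≤-Reasoning

AE-not-properPrefix-b∷++ : ∀ {x y z} w ws → IsAE x → IsAE y → IsAE z →
  ¬ (x ++ w ∷ ws ≡ b ∷ y ++ z)
AE-not-properPrefix-b∷++ {[]}     w ws (() , _) _ _ _
AE-not-properPrefix-b∷++ {c ∷ x′} w ws (total , _) aeY aeZ eq with ∷-injective eq
... | refl , eq′ = n≮n (suc (countB x′))
  (subst (_≤ suc (countB x′)) total (properPrefix-++-excess≤1 x′ w ws aeY aeZ eq′))

Infix-++⁻ : ∀ {x y z} p q → IsAE x → IsAE y → p ++ x ++ q ≡ y ++ z → Infix x y ⊎ Infix x z
Infix-++⁻ {x} {y} {z} p q aeX aeY eq with ++-equidivisible p (x ++ q) y z eq
... | inj₁ (m , _ , z≡m++x++q) = inj₂ (m , q , sym z≡m++x++q)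
... | inj₂ (m , y≡p++m , x++q≡m++z) with ++-equidivisible x q m z x++q≡m++z
...   | inj₂ (n , m≡x++n , _) = inj₁ (p , n , sym (trans y≡p++m (cong (p ++_) m≡x++n)))
...   | inj₁ (n , x≡m++n , z≡n++q)
        with AE-overlap-trivial p m n aeX aeY (sym y≡p++m) (sym x≡m++n)
...     | inj₁ refl = inj₂ ([] , q , trans (cong (_++ q) x≡m++n) (sym z≡n++q))
...     | inj₂ refl = inj₁ (p , [] , trans (cong (p ++_) x≡m) (sym y≡p++m))
  where
  x≡m : x ++ [] ≡ m
  x≡m = trans (++-identityʳ x) (trans x≡m++n (++-identityʳ m))

Infix-b∷++⁻ : ∀ {x y z} → IsAE x → IsAE y → IsAE z → Infix x (b ∷ y ++ z) →
  x ≡ b ∷ y ++ z ⊎ Infix x y ⊎ Infix x z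
Infix-b∷++⁻ {x} _ _ _     ([]    , []     , eq) = inj₁ (trans (sym (++-identityʳ x)) eq)
Infix-b∷++⁻ aeX aeY aeZ   ([]    , w ∷ ws , eq) =
  ⊥-elim (AE-not-properPrefix-b∷++ w ws aeX aeY aeZ eq)
Infix-b∷++⁻ aeX aeY _     (_ ∷ p , q      , eq) = inj₂ (Infix-++⁻ p q aeX aeY (∷-injectiveʳ eq))

mainTheorem4 : (x y z : Str) → AE x → AE y → AE z → x ⊆p (𝕓 * y * z) →
    (x ≡ 𝕓 * y * z) ⊎ (x ⊆p y) ⊎ (x ⊆p z)
-- toList (𝕓 * y * z) is b ∷ toList y ++ toList z definitionally, by η for List⁺.
mainTheorem4 x y z aeX aeY aeZ x⊆b*y*z =
  Sum.map toList-injective (Sum.map Infix⇒⊆p Infix⇒⊆p)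
    (Infix-b∷++⁻ (AE⇒IsAE aeX) (AE⇒IsAE aeY) (AE⇒IsAE aeZ) (⊆p⇒Infix x⊆b*y*z))
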